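{- Let $f = x + b_1 x^2 + b_2 x^3 + \cdots$ be a formal power series (with coefficients in a commutative ring, e.g. $\mathbb{C}$). Define $f^{(0)} = x$ and $f^{(i)} = f(f^{(i-1)})$ for $i>0$ (composition of power series). Define a matrix $c$ by \[ c_{i,j} = [x^{j+1}] f^{(i)} \qquad (i,j \geq 0). \] Then \[ \det \left( (c_{i,j})_{i,j=0}^n\right) = 1!\, 2! \cdots n!\; b_1^{n(n+1)/2} \qquad (n = 0,1,2,\dots). \]
   Context: For a formal power series $g$, $[x^j] g$ denotes the coefficient of $x^j$ in $g$. The iterates $f^{(i)}$ are well defined since $f$ has no constant term. -}

module Defs where

open import Level using (Level)
open import Algebra.Bundles using (CommutativeRing)
open import Data.Nat using (ℕ; zero; suc; _∸_; _!)
open import Data.Fin using (Fin; zero; suc; toℕ; punchIn)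

module _ {c ℓ : Level} (R : CommutativeRing c ℓ) where
  open CommutativeRing R hiding (zero)

  -- formal power series over R: n ↦ coefficient of x^n
  Series : Set c
  Series = ℕ → Carrier

  Σ< : ℕ → (ℕ → Carrier) → Carrier
  Σ< zero    g = 0#
  Σ< (suc n) g = Σ< n g + g n

  ΣFin : ∀ {n} → (Fin n → Carrier) → Carrier
  ΣFin {zero}  g = 0#
  ΣFin {suc n} g = g zero + ΣFin (λ i → g (suc i))

  powR : Carrier → ℕ → Carrier
  powR a zero    = 1#
  powR a (suc k) = a * powR a k

  fromℕ : ℕ → Carrier
  fromℕ zero    = 0#
  fromℕ (suc n) = 1# + fromℕ n

  oneS : Series
  oneS zero    = 1#
  oneS (suc _) = 0#

  X : Series
  X 1 = 1#
  X _ = 0#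

  mulS : Series → Series → Series
  mulS a b n = Σ< (suc n) (λ k → a k * b (n ∸ k))

  powS : Series → ℕ → Series
  powS g zero    = oneS
  powS g (suc k) = mulS g (powS g k)

  -- composition f(g) = Σ_k f_k g^k, valid (as a finite sum per coefficient)
  -- when g has zero constant term: [x^n] g^k = 0 for k > n.
  comp : Series → Series → Series
  comp f g n = Σ< (suc n) (λ k → f k * powS g k n)

  iter : Series → ℕ → Series
  iter f zero    = X
  iter f (suc i) = comp f (iter f i)

  det : ∀ n → (Fin n → Fin n → Carrier) → Carrier
  det zero    M = 1#
  det (suc n) M =
    ΣFin (λ j → powR (- 1#) (toℕ j) * (M zero j * det n (λ r s → M (suc r) (punchIn j s))))

  superfact : ℕ → Carrier
  superfact zero    = 1#
  superfact (suc n) = superfact n * fromℕ ((suc n) !)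

{-# OPTIONS --safe #-}
module Submission where

-- Associativity of composition gives f⁽ⁱ⁺¹⁾ = f⁽ⁱ⁾ ∘ f, and as f⁽ⁱ⁾ has no constant term the rows of c
-- satisfy c_{i+1} = c_i P, where P_{m,j} = [x^{j+1}] f^{m+1} is upper unitriangular with superdiagonal
-- entries P_{k,k+1} = (k+1) b₁. Hence the k-th forward difference Δᵏ c_i = c_i (P - 1)ᵏ vanishes before
-- column k and equals k! b₁ᵏ in column k. Replacing row k of the matrix by Δᵏ c_0 only subtracts earlier
-- rows, so the determinant is that of an upper triangular matrix with diagonal entries k! b₁ᵏ.

open import Level using (Level)
open import Algebra.Bundles using (CommutativeRing)
open import Data.Nat as ℕ using (ℕ; zero; suc; _∸_; _!; z≤n; s≤s; _≤′_; ≤′-refl; ≤′-step)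
import Data.Nat.Properties as ℕ
open import Data.Nat.DivMod using (m*n/n≡m; +-distrib-/-∣ʳ)
open import Data.Nat.Divisibility using (n∣m*n)
open import Data.Nat.Solver using (module +-*-Solver)
open import Data.Fin using (Fin; zero; suc; toℕ; punchIn; pinch; inject₁) renaming (fromℕ to fromℕᶠ)
open import Data.Fin.Properties using (toℕ-inject₁; toℕ-fromℕ)
open import Data.Empty using (⊥-elim)
open import Function using (_∘_)
open import Relation.Binary.PropositionalEquality as ≡ using (_≡_; _≢_)
import Relation.Binary.Reasoning.Setoid as SetoidReasoning
open import Defs

triangle-suc : ∀ n → (suc n ℕ.* suc (suc n)) ℕ./ 2 ≡ (n ℕ.* suc n) ℕ./ 2 ℕ.+ suc n
triangle-suc n = begin
  (suc n ℕ.* suc (suc n)) ℕ./ 2               ≡⟨ ≡.cong (ℕ._/ 2) (expand n) ⟩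
  (n ℕ.* suc n ℕ.+ suc n ℕ.* 2) ℕ./ 2         ≡⟨ +-distrib-/-∣ʳ (n ℕ.* suc n) (n∣m*n (suc n)) ⟩
  (n ℕ.* suc n) ℕ./ 2 ℕ.+ suc n ℕ.* 2 ℕ./ 2   ≡⟨ ≡.cong ((n ℕ.* suc n) ℕ./ 2 ℕ.+_) (m*n/n≡m (suc n) 2) ⟩
  (n ℕ.* suc n) ℕ./ 2 ℕ.+ suc n               ∎
  where
  open ≡.≡-Reasoning
  open +-*-Solver
  expand : ∀ n → suc n ℕ.* suc (suc n) ≡ n ℕ.* suc n ℕ.+ suc n ℕ.* 2
  expand = solve 1 (λ n → (con 1 :+ n) :* (con 2 :+ n) := n :* (con 1 :+ n) :+ (con 1 :+ n) :* con 2) ≡.refl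

module _ {c ℓ : Level} (R : CommutativeRing c ℓ) where
  open CommutativeRing R hiding (zero)
  open import Algebra.Properties.Ring ring
    using (-1*x≈-x; [y-z]x≈yx-zx; -‿distribʳ-*; -‿involutive; -‿+-comm; //-rightDividesʳ)
  open import Algebra.Properties.CommutativeSemigroup +-commutativeSemigroup
    using () renaming (interchange to +-interchange)
  open import Algebra.Properties.CommutativeSemigroup *-commutativeSemigroup
    using (x∙yz≈y∙xz) renaming (interchange to *-interchange)
  open SetoidReasoning setoid
  open import Algebra.Properties.CommutativeMonoid.Sum +-commutativeMonoid
    using (sum; sum-cong-≋; sum-replicate-zero; ∑-distrib-+)
  open import Algebra.Properties.Monoid.Sum *-monoid
    using () renaming (sum to ∏; sum-cong-≋ to ∏-cong-≋; sum-init-last to ∏-init-last)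
  open import Algebra.Properties.Semiring.Sum semiring using (*-distribˡ-sum)

  fromℕ-homo-* : ∀ m n → fromℕ R (m ℕ.* n) ≈ fromℕ R m * fromℕ R n
  fromℕ-homo-* m n = begin
    fromℕ R (m ℕ.* n)          ≡⟨ fromℕ≡×1# (m ℕ.* n) ⟩
    (m ℕ.* n) × 1#             ≈⟨ ×1-homo-* m n ⟩
    (m × 1#) * (n × 1#)        ≡⟨ ≡.cong₂ _*_ (fromℕ≡×1# m) (fromℕ≡×1# n) ⟨
    fromℕ R m * fromℕ R n      ∎
    where
    open import Algebra.Properties.Semiring.Mult semiring using (_×_; ×1-homo-*)
    fromℕ≡×1# : ∀ n → fromℕ R n ≡ n × 1#
    fromℕ≡×1# zero    = ≡.refl
    fromℕ≡×1# (suc n) = ≡.cong (1# +_) (fromℕ≡×1# n)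

  powR-homo-+ : ∀ a m n → powR R a (m ℕ.+ n) ≈ powR R a m * powR R a n
  powR-homo-+ a m n = begin
    powR R a (m ℕ.+ n)          ≡⟨ powR≡^ (m ℕ.+ n) ⟩
    a ^ (m ℕ.+ n)               ≈⟨ ^-homo-* a m n ⟩
    a ^ m * a ^ n               ≡⟨ ≡.cong₂ _*_ (powR≡^ m) (powR≡^ n) ⟨
    powR R a m * powR R a n     ∎
    where
    open import Algebra.Properties.Semiring.Exp semiring using (_^_; ^-homo-*)
    powR≡^ : ∀ n → powR R a n ≡ a ^ n
    powR≡^ zero    = ≡.refl
    powR≡^ (suc n) = ≡.cong (a *_) (powR≡^ n)

  ∏-factorialPowers : ∀ b n → ∏ (λ (i : Fin (suc n)) → fromℕ R (toℕ i !) * powR R b (toℕ i)) ≈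
                              superfact R n * powR R b ((n ℕ.* suc n) ℕ./ 2)
  ∏-factorialPowers b zero    = *-cong (trans (*-identityʳ _) (+-identityʳ 1#)) refl
  ∏-factorialPowers b (suc n) = begin
    ∏ (λ (i : Fin (suc (suc n))) → d (toℕ i))
      ≈⟨ ∏-init-last (λ (i : Fin (suc (suc n))) → d (toℕ i)) ⟩
    ∏ (λ (i : Fin (suc n)) → d (toℕ (inject₁ i))) * d (toℕ (fromℕᶠ (suc n)))
      ≈⟨ *-cong (∏-cong-≋ {x = λ (i : Fin (suc n)) → d (toℕ (inject₁ i))} {y = λ i → d (toℕ i)}
                           (λ i → reflexive (≡.cong d (toℕ-inject₁ i))))
                (reflexive (≡.cong d (toℕ-fromℕ (suc n)))) ⟩
    ∏ (λ (i : Fin (suc n)) → d (toℕ i)) * d (suc n)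
      ≈⟨ *-cong (∏-factorialPowers b n) refl ⟩
    (superfact R n * powR R b T) * (fromℕ R (suc n !) * powR R b (suc n))
      ≈⟨ *-interchange _ _ _ _ ⟩
    superfact R (suc n) * (powR R b T * powR R b (suc n))
      ≈⟨ *-cong refl (powR-homo-+ b T (suc n)) ⟨
    superfact R (suc n) * powR R b (T ℕ.+ suc n)
      ≡⟨ ≡.cong (λ e → superfact R (suc n) * powR R b e) (triangle-suc n) ⟨
    superfact R (suc n) * powR R b ((suc n ℕ.* suc (suc n)) ℕ./ 2)
      ∎
    where
    d : ℕ → Carrier
    d k = fromℕ R (k !) * powR R b k
    T : ℕ
    T = (n ℕ.* suc n) ℕ./ 2

  Σ<-cong : ∀ n {g h : ℕ → Carrier} → (∀ k → k ℕ.< n → g k ≈ h k) → Σ< R n g ≈ Σ< R n h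
  Σ<-cong zero    g≈h = refl
  Σ<-cong (suc n) g≈h = +-cong (Σ<-cong n (λ k k<n → g≈h k (ℕ.m<n⇒m<1+n k<n))) (g≈h n ℕ.≤-refl)

  Σ<-zero : ∀ n {g : ℕ → Carrier} → (∀ k → k ℕ.< n → g k ≈ 0#) → Σ< R n g ≈ 0#
  Σ<-zero zero    g≈0 = refl
  Σ<-zero (suc n) g≈0 =
    trans (+-cong (Σ<-zero n (λ k k<n → g≈0 k (ℕ.m<n⇒m<1+n k<n))) (g≈0 n ℕ.≤-refl)) (+-identityʳ 0#)

  Σ<-distrib-+ : ∀ n (g h : ℕ → Carrier) → Σ< R n (λ k → g k + h k) ≈ Σ< R n g + Σ< R n h
  Σ<-distrib-+ zero    g h = sym (+-identityʳ 0#)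
  Σ<-distrib-+ (suc n) g h = trans (+-cong (Σ<-distrib-+ n g h) refl) (+-interchange _ _ _ _)

  *-distribˡ-Σ< : ∀ n a (g : ℕ → Carrier) → a * Σ< R n g ≈ Σ< R n (λ k → a * g k)
  *-distribˡ-Σ< zero    a g = zeroʳ a
  *-distribˡ-Σ< (suc n) a g = trans (distribˡ a _ _) (+-cong (*-distribˡ-Σ< n a g) refl)

  *-distribʳ-Σ< : ∀ n a (g : ℕ → Carrier) → Σ< R n g * a ≈ Σ< R n (λ k → g k * a)
  *-distribʳ-Σ< n a g =
    trans (*-comm _ a) (trans (*-distribˡ-Σ< n a g) (Σ<-cong n (λ k _ → *-comm a (g k))))

  -‿distrib-Σ< : ∀ n (g : ℕ → Carrier) → - Σ< R n g ≈ Σ< R n (λ k → - g k)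
  -‿distrib-Σ< n g = begin
    - Σ< R n g                   ≈⟨ -1*x≈-x _ ⟨
    - 1# * Σ< R n g              ≈⟨ *-distribˡ-Σ< n (- 1#) g ⟩
    Σ< R n (λ k → - 1# * g k)    ≈⟨ Σ<-cong n (λ k _ → -1*x≈-x (g k)) ⟩
    Σ< R n (λ k → - g k)         ∎

  Σ<-head : ∀ n (g : ℕ → Carrier) → Σ< R (suc n) g ≈ g 0 + Σ< R n (λ k → g (suc k))
  Σ<-head zero    g = trans (+-identityˡ _) (sym (+-identityʳ _))
  Σ<-head (suc n) g = trans (+-cong (Σ<-head n g) refl) (+-assoc _ _ _)

  Σ<-tail : ∀ n {g : ℕ → Carrier} → g 0 ≈ 0# → Σ< R (suc n) g ≈ Σ< R n (λ k → g (suc k))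
  Σ<-tail n {g} g0≈0 = trans (Σ<-head n g) (trans (+-cong g0≈0 refl) (+-identityˡ _))

  Σ<-comm : ∀ n m (F : ℕ → ℕ → Carrier) →
    Σ< R n (λ i → Σ< R m (F i)) ≈ Σ< R m (λ j → Σ< R n (λ i → F i j))
  Σ<-comm zero    m F = sym (Σ<-zero m (λ _ _ → refl))
  Σ<-comm (suc n) m F =
    trans (+-cong (Σ<-comm n m F) refl) (sym (Σ<-distrib-+ m (λ j → Σ< R n (λ i → F i j)) (F n)))

  Σ<-extend : ∀ {n} N {g : ℕ → Carrier} → n ℕ.≤ N → (∀ k → n ℕ.≤ k → k ℕ.< N → g k ≈ 0#) →
    Σ< R N g ≈ Σ< R n g
  Σ<-extend {n} N {g} n≤N = go (ℕ.≤⇒≤′ n≤N)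
    where
    go : ∀ {N} → n ≤′ N → (∀ k → n ℕ.≤ k → k ℕ.< N → g k ≈ 0#) → Σ< R N g ≈ Σ< R n g
    go ≤′-refl             _   = refl
    go (≤′-step {N} n≤′N) g≈0 = trans
      (+-cong (go n≤′N (λ k n≤k k<N → g≈0 k n≤k (ℕ.m<n⇒m<1+n k<N))) (g≈0 N (ℕ.≤′⇒≤ n≤′N) ℕ.≤-refl))
      (+-identityʳ _)

  Σ<-single : ∀ n p {g : ℕ → Carrier} → p ℕ.< n → (∀ k → k ℕ.< n → k ≢ p → g k ≈ 0#) → Σ< R n g ≈ g p
  Σ<-single n p {g} p<n g≈0 = begin
    Σ< R n g             ≈⟨ Σ<-extend n p<n (λ k p<k k<n → g≈0 k k<n (ℕ.>⇒≢ p<k)) ⟩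
    Σ< R p g + g p       ≈⟨ +-cong (Σ<-zero p (λ k k<p → g≈0 k (ℕ.<-trans k<p p<n) (ℕ.<⇒≢ k<p))) refl ⟩
    0# + g p             ≈⟨ +-identityˡ (g p) ⟩
    g p                  ∎

  Σ<-triangle : ∀ N (G : ℕ → ℕ → Carrier) →
    Σ< R N (λ q → Σ< R (suc q) (λ p → G p q)) ≈ Σ< R N (λ p → Σ< R (N ∸ p) (λ r → G p (p ℕ.+ r)))
  Σ<-triangle zero    G = refl
  Σ<-triangle (suc N) G = begin
    Σ< R N (λ q → Σ< R (suc q) (λ p → G p q)) + Σ< R (suc N) (λ p → G p N)
      ≈⟨ +-cong (Σ<-triangle N G) refl ⟩
    Σ< R N H + Σ< R (suc N) (λ p → G p N)
      ≈⟨ +-cong (Σ<-extend (suc N) (ℕ.n≤1+n N) H-vanishes) refl ⟨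
    Σ< R (suc N) H + Σ< R (suc N) (λ p → G p N)
      ≈⟨ Σ<-distrib-+ (suc N) H (λ p → G p N) ⟨
    Σ< R (suc N) (λ p → H p + G p N)
      ≈⟨ Σ<-cong (suc N) (λ p p≤N → H-snoc (ℕ.≤-pred p≤N)) ⟩
    Σ< R (suc N) (λ p → Σ< R (suc N ∸ p) (λ r → G p (p ℕ.+ r)))
      ∎
    where
    H : ℕ → Carrier
    H p = Σ< R (N ∸ p) (λ r → G p (p ℕ.+ r))
    H-vanishes : ∀ k → N ℕ.≤ k → k ℕ.< suc N → H k ≈ 0#
    H-vanishes k N≤k _ = reflexive (≡.cong (λ m → Σ< R m (λ r → G k (k ℕ.+ r))) (ℕ.m≤n⇒m∸n≡0 N≤k))
    H-snoc : ∀ {p} → p ℕ.≤ N → H p + G p N ≈ Σ< R (suc N ∸ p) (λ r → G p (p ℕ.+ r))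
    H-snoc {p} p≤N = begin
      H p + G p N
        ≡⟨ ≡.cong (λ q → H p + G p q) (ℕ.m+[n∸m]≡n p≤N) ⟨
      Σ< R (suc (N ∸ p)) (λ r → G p (p ℕ.+ r))
        ≡⟨ ≡.cong (λ m → Σ< R m (λ r → G p (p ℕ.+ r))) (ℕ.+-∸-assoc 1 p≤N) ⟨
      Σ< R (suc N ∸ p) (λ r → G p (p ℕ.+ r))
        ∎

  Σ<-*-Σ< : ∀ n m (g h : ℕ → Carrier) → Σ< R n g * Σ< R m h ≈ Σ< R n (λ p → Σ< R m (λ r → g p * h r))
  Σ<-*-Σ< n m g h = trans (*-distribʳ-Σ< n _ g) (Σ<-cong n (λ p _ → *-distribˡ-Σ< m (g p) h))

  -- Formal power series

  infix 4 _≋_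
  _≋_ : Series R → Series R → Set ℓ
  a ≋ b = ∀ n → a n ≈ b n

  mulS-cong : ∀ {a a′ b b′} → a ≋ a′ → b ≋ b′ → mulS R a b ≋ mulS R a′ b′
  mulS-cong a≋a′ b≋b′ n = Σ<-cong (suc n) (λ k _ → *-cong (a≋a′ k) (b≋b′ (n ∸ k)))

  powS-cong : ∀ {g g′} → g ≋ g′ → ∀ k → powS R g k ≋ powS R g′ k
  powS-cong g≋g′ zero    n = refl
  powS-cong g≋g′ (suc k)   = mulS-cong g≋g′ (powS-cong g≋g′ k)

  mulS-identityˡ : ∀ b → mulS R (oneS R) b ≋ b
  mulS-identityˡ b n = begin
    Σ< R (suc n) (λ k → oneS R k * b (n ∸ k))
      ≈⟨ Σ<-head n _ ⟩
    1# * b n + Σ< R n (λ k → 0# * b (n ∸ suc k))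
      ≈⟨ +-cong (*-identityˡ (b n)) (Σ<-zero n (λ k _ → zeroˡ _)) ⟩
    b n + 0#
      ≈⟨ +-identityʳ (b n) ⟩
    b n
      ∎

  mulS-identityʳ : ∀ a → mulS R a (oneS R) ≋ a
  mulS-identityʳ a n = begin
    mulS R a (oneS R) n      ≈⟨ Σ<-single (suc n) n ℕ.≤-refl off-diagonal ⟩
    a n * oneS R (n ∸ n)     ≡⟨ ≡.cong (λ k → a n * oneS R k) (ℕ.n∸n≡0 n) ⟩
    a n * 1#                 ≈⟨ *-identityʳ (a n) ⟩
    a n                      ∎
    where
    oneS-∸ : ∀ {n k} → k ℕ.< n → oneS R (n ∸ k) ≈ 0#
    oneS-∸ {suc n} {zero}  _         = refl
    oneS-∸ {suc n} {suc k} (s≤s k<n) = oneS-∸ k<n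
    off-diagonal : ∀ k → k ℕ.< suc n → k ≢ n → a k * oneS R (n ∸ k) ≈ 0#
    off-diagonal k k≤n k≢n = trans (*-cong refl (oneS-∸ (ℕ.≤∧≢⇒< (ℕ.≤-pred k≤n) k≢n))) (zeroʳ _)

  mulS-suc : ∀ {a} b n → a 0 ≈ 0# → mulS R a b (suc n) ≈ Σ< R (suc n) (λ p → a (suc p) * b (n ∸ p))
  mulS-suc b n a0≈0 = Σ<-tail (suc n) (trans (*-cong a0≈0 refl) (zeroˡ _))

  Σ<-mulS : ∀ N (a b w : Series R) →
    Σ< R N (λ q → mulS R a b q * w q) ≈ Σ< R N (λ p → a p * Σ< R (N ∸ p) (λ r → b r * w (p ℕ.+ r)))
  Σ<-mulS N a b w = begin
    Σ< R N (λ q → mulS R a b q * w q)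
      ≈⟨ Σ<-cong N (λ q _ → *-distribʳ-Σ< (suc q) (w q) _) ⟩
    Σ< R N (λ q → Σ< R (suc q) (λ p → (a p * b (q ∸ p)) * w q))
      ≈⟨ Σ<-triangle N (λ p q → (a p * b (q ∸ p)) * w q) ⟩
    Σ< R N (λ p → Σ< R (N ∸ p) (λ r → (a p * b (p ℕ.+ r ∸ p)) * w (p ℕ.+ r)))
      ≈⟨ Σ<-cong N (λ p _ → Σ<-cong (N ∸ p) (λ r _ → reassoc p r)) ⟩
    Σ< R N (λ p → Σ< R (N ∸ p) (λ r → a p * (b r * w (p ℕ.+ r))))
      ≈⟨ Σ<-cong N (λ p _ → *-distribˡ-Σ< (N ∸ p) (a p) _) ⟨
    Σ< R N (λ p → a p * Σ< R (N ∸ p) (λ r → b r * w (p ℕ.+ r)))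
      ∎
    where
    reassoc : ∀ p r → (a p * b (p ℕ.+ r ∸ p)) * w (p ℕ.+ r) ≈ a p * (b r * w (p ℕ.+ r))
    reassoc p r = trans (*-assoc _ _ _) (reflexive (≡.cong (λ k → a p * (b k * w (p ℕ.+ r))) (ℕ.m+n∸m≡n p r)))

  mulS-assoc : ∀ a b c → mulS R (mulS R a b) c ≋ mulS R a (mulS R b c)
  mulS-assoc a b c n = trans (Σ<-mulS (suc n) a b (λ q → c (n ∸ q)))
    (Σ<-cong (suc n) (λ p p≤n → *-cong refl (inner (ℕ.≤-pred p≤n))))
    where
    inner : ∀ {p} → p ℕ.≤ n → Σ< R (suc n ∸ p) (λ r → b r * c (n ∸ (p ℕ.+ r))) ≈ mulS R b c (n ∸ p)
    inner {p} p≤n = begin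
      Σ< R (suc n ∸ p) (λ r → b r * c (n ∸ (p ℕ.+ r)))
        ≡⟨ ≡.cong (λ m → Σ< R m (λ r → b r * c (n ∸ (p ℕ.+ r)))) (ℕ.+-∸-assoc 1 p≤n) ⟩
      Σ< R (suc (n ∸ p)) (λ r → b r * c (n ∸ (p ℕ.+ r)))
        ≈⟨ Σ<-cong (suc (n ∸ p)) (λ r _ → reflexive (≡.cong (λ k → b r * c k) (ℕ.∸-+-assoc n p r))) ⟨
      Σ< R (suc (n ∸ p)) (λ r → b r * c (n ∸ p ∸ r))
        ∎

  powS-vanish : ∀ {g} → g 0 ≈ 0# → ∀ k n → n ℕ.< k → powS R g k n ≈ 0#
  powS-vanish     g0≈0 (suc k) zero    _         = trans (+-identityˡ _) (trans (*-cong g0≈0 refl) (zeroˡ _))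
  powS-vanish {g} g0≈0 (suc k) (suc n) (s≤s n<k) = trans (mulS-suc (powS R g k) n g0≈0)
    (Σ<-zero (suc n) (λ p _ →
      trans (*-cong refl (powS-vanish g0≈0 k (n ∸ p) (ℕ.≤-<-trans (ℕ.m∸n≤m n p) n<k))) (zeroʳ _)))

  powS-homo-+ : ∀ g p r → powS R g (p ℕ.+ r) ≋ mulS R (powS R g p) (powS R g r)
  powS-homo-+ g zero    r n = sym (mulS-identityˡ (powS R g r) n)
  powS-homo-+ g (suc p) r n =
    trans (mulS-cong (λ _ → refl) (powS-homo-+ g p r) n) (sym (mulS-assoc g (powS R g p) (powS R g r) n))

  comp-cong : ∀ {a a′ h h′} → a ≋ a′ → h ≋ h′ → comp R a h ≋ comp R a′ h′
  comp-cong a≋a′ h≋h′ n = Σ<-cong (suc n) (λ k _ → *-cong (a≋a′ k) (powS-cong h≋h′ k n))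

  comp-extend : ∀ a {h} → h 0 ≈ 0# → ∀ {n} N → n ℕ.< N → comp R a h n ≈ Σ< R N (λ k → a k * powS R h k n)
  comp-extend a h0≈0 {n} N n<N =
    sym (Σ<-extend N n<N (λ k n<k _ → trans (*-cong refl (powS-vanish h0≈0 k n n<k)) (zeroʳ _)))

  comp-vanish : ∀ a h → a 0 ≈ 0# → comp R a h 0 ≈ 0#
  comp-vanish a h a0≈0 = trans (+-identityˡ _) (trans (*-cong a0≈0 refl) (zeroˡ _))

  comp-mulS : ∀ a b {h} → h 0 ≈ 0# → comp R (mulS R a b) h ≋ mulS R (comp R a h) (comp R b h)
  comp-mulS a b {h} h0≈0 n = begin
    comp R (mulS R a b) h n
      ≈⟨ Σ<-mulS N a b (λ k → powS R h k n) ⟩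
    Σ< R N (λ p → a p * Σ< R (N ∸ p) (λ r → b r * powS R h (p ℕ.+ r) n))
      ≈⟨ Σ<-cong N (λ p _ → *-cong refl (Σ<-extend N (ℕ.m∸n≤m N p) (λ r N∸p≤r _ → tail-vanish p r N∸p≤r))) ⟨
    Σ< R N (λ p → a p * Σ< R N (λ r → b r * powS R h (p ℕ.+ r) n))
      ≈⟨ Σ<-cong N (λ p _ → trans (*-distribˡ-Σ< N (a p) _) (Σ<-cong N (λ r _ → expand p r))) ⟩
    Σ< R N (λ p → Σ< R N (λ r → Σ< R N (λ q → (a p * x p q) * (b r * y r q))))
      ≈⟨ Σ<-cong N (λ p _ → Σ<-comm N N _) ⟩
    Σ< R N (λ p → Σ< R N (λ q → Σ< R N (λ r → (a p * x p q) * (b r * y r q))))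
      ≈⟨ Σ<-comm N N _ ⟩
    Σ< R N (λ q → Σ< R N (λ p → Σ< R N (λ r → (a p * x p q) * (b r * y r q))))
      ≈⟨ Σ<-cong N (λ q _ → Σ<-*-Σ< N N (λ p → a p * x p q) (λ r → b r * y r q)) ⟨
    Σ< R N (λ q → Σ< R N (λ p → a p * x p q) * Σ< R N (λ r → b r * y r q))
      ≈⟨ Σ<-cong N (λ q q<N → *-cong (comp-extend a h0≈0 N q<N) (comp-extend b h0≈0 N (s≤s (ℕ.m∸n≤m n q)))) ⟨
    mulS R (comp R a h) (comp R b h) n
      ∎
    where
    N : ℕ
    N = suc n
    x y : ℕ → ℕ → Carrier
    x p q = powS R h p q
    y r q = powS R h r (n ∸ q)
    tail-vanish : ∀ p r → N ∸ p ℕ.≤ r → b r * powS R h (p ℕ.+ r) n ≈ 0#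
    tail-vanish p r N∸p≤r = trans (*-cong refl (powS-vanish h0≈0 (p ℕ.+ r) n
      (ℕ.≤-trans (ℕ.m≤n+m∸n N p) (ℕ.+-monoʳ-≤ p N∸p≤r)))) (zeroʳ _)
    expand : ∀ p r → a p * (b r * powS R h (p ℕ.+ r) n) ≈ Σ< R N (λ q → (a p * x p q) * (b r * y r q))
    expand p r = begin
      a p * (b r * powS R h (p ℕ.+ r) n)           ≈⟨ *-cong refl (*-cong refl (powS-homo-+ h p r n)) ⟩
      a p * (b r * Σ< R N (λ q → x p q * y r q))    ≈⟨ *-assoc _ _ _ ⟨
      (a p * b r) * Σ< R N (λ q → x p q * y r q)    ≈⟨ *-distribˡ-Σ< N (a p * b r) _ ⟩
      Σ< R N (λ q → (a p * b r) * (x p q * y r q))  ≈⟨ Σ<-cong N (λ q _ → *-interchange _ _ _ _) ⟩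
      Σ< R N (λ q → (a p * x p q) * (b r * y r q))  ∎

  comp-oneS : ∀ h → comp R (oneS R) h ≋ oneS R
  comp-oneS h n = begin
    Σ< R (suc n) (λ k → oneS R k * powS R h k n)
      ≈⟨ Σ<-head n _ ⟩
    1# * oneS R n + Σ< R n (λ k → 0# * powS R h (suc k) n)
      ≈⟨ +-cong (*-identityˡ _) (Σ<-zero n (λ k _ → zeroˡ _)) ⟩
    oneS R n + 0#
      ≈⟨ +-identityʳ _ ⟩
    oneS R n
      ∎

  comp-powS : ∀ g {h} → h 0 ≈ 0# → ∀ k → comp R (powS R g k) h ≋ powS R (comp R g h) k
  comp-powS g h0≈0 zero    = comp-oneS _
  comp-powS g h0≈0 (suc k) n =
    trans (comp-mulS g (powS R g k) h0≈0 n) (mulS-cong (λ _ → refl) (comp-powS g h0≈0 k) n)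

  comp-assoc : ∀ f {g h} → g 0 ≈ 0# → h 0 ≈ 0# → comp R (comp R f g) h ≋ comp R f (comp R g h)
  comp-assoc f {g} {h} g0≈0 h0≈0 n = begin
    Σ< R N (λ q → comp R f g q * powS R h q n)
      ≈⟨ Σ<-cong N (λ q q<N → trans (*-cong (comp-extend f g0≈0 N q<N) refl) (*-distribʳ-Σ< N _ _)) ⟩
    Σ< R N (λ q → Σ< R N (λ k → (f k * powS R g k q) * powS R h q n))
      ≈⟨ Σ<-comm N N _ ⟩
    Σ< R N (λ k → Σ< R N (λ q → (f k * powS R g k q) * powS R h q n))
      ≈⟨ Σ<-cong N (λ k _ → trans (Σ<-cong N (λ q _ → *-assoc _ _ _)) (sym (*-distribˡ-Σ< N (f k) _))) ⟩
    Σ< R N (λ k → f k * comp R (powS R g k) h n)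
      ≈⟨ Σ<-cong N (λ k _ → *-cong refl (comp-powS g h0≈0 k n)) ⟩
    Σ< R N (λ k → f k * powS R (comp R g h) k n)
      ∎
    where
    N : ℕ
    N = suc n

  powS-X-suc : ∀ k n → powS R (X R) (suc k) (suc n) ≈ powS R (X R) k n
  powS-X-suc k n = begin
    powS R (X R) (suc k) (suc n)
      ≈⟨ mulS-suc (powS R (X R) k) n refl ⟩
    Σ< R (suc n) (λ p → X R (suc p) * powS R (X R) k (n ∸ p))
      ≈⟨ Σ<-head n _ ⟩
    1# * powS R (X R) k n + Σ< R n (λ p → 0# * powS R (X R) k (n ∸ suc p))
      ≈⟨ +-cong (*-identityˡ _) (Σ<-zero n (λ _ _ → zeroˡ _)) ⟩
    powS R (X R) k n + 0#
      ≈⟨ +-identityʳ _ ⟩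
    powS R (X R) k n
      ∎

  powS-X-diag : ∀ k → powS R (X R) k k ≈ 1#
  powS-X-diag zero    = refl
  powS-X-diag (suc k) = trans (powS-X-suc k k) (powS-X-diag k)

  powS-X-off : ∀ k n → k ≢ n → powS R (X R) k n ≈ 0#
  powS-X-off zero    zero    k≢n = ⊥-elim (k≢n ≡.refl)
  powS-X-off zero    (suc n) _   = refl
  powS-X-off (suc k) zero    _   = powS-vanish refl (suc k) 0 (s≤s z≤n)
  powS-X-off (suc k) (suc n) k≢n = trans (powS-X-suc k n) (powS-X-off k n (k≢n ∘ ≡.cong suc))

  comp-identityʳ : ∀ f → comp R f (X R) ≋ f
  comp-identityʳ f n = trans
    (Σ<-single (suc n) n ℕ.≤-refl (λ k _ k≢n → trans (*-cong refl (powS-X-off k n k≢n)) (zeroʳ _)))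
    (trans (*-cong refl (powS-X-diag n)) (*-identityʳ (f n)))

  comp-identityˡ : ∀ {f} → f 0 ≈ 0# → comp R (X R) f ≋ f
  comp-identityˡ {f} f0≈0 zero    = trans (comp-vanish (X R) f refl) (sym f0≈0)
  comp-identityˡ {f} f0≈0 (suc n) = begin
    comp R (X R) f (suc n)        ≈⟨ Σ<-single (suc (suc n)) 1 (s≤s (s≤s z≤n)) only-x¹ ⟩
    1# * powS R f 1 (suc n)       ≈⟨ *-identityˡ _ ⟩
    mulS R f (oneS R) (suc n)     ≈⟨ mulS-identityʳ f (suc n) ⟩
    f (suc n)                     ∎
    where
    only-x¹ : ∀ k → k ℕ.< suc (suc n) → k ≢ 1 → X R k * powS R f k (suc n) ≈ 0#
    only-x¹ zero          _ _   = zeroˡ _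
    only-x¹ (suc zero)    _ k≢1 = ⊥-elim (k≢1 ≡.refl)
    only-x¹ (suc (suc k)) _ _   = zeroˡ _

  -- Forward differences of a row recurrence

  Matrix : Set c
  Matrix = ℕ → ℕ → Carrier

  Δ : Matrix → Matrix
  Δ A i j = A (suc i) j - A i j

  Δ^ : ℕ → Matrix → Matrix
  Δ^ zero    A = A
  Δ^ (suc k) A = Δ (Δ^ k A)

  Δ^-Δ : ∀ k A i j → Δ^ k (Δ A) i j ≡ Δ^ (suc k) A i j
  Δ^-Δ zero    A i j = ≡.refl
  Δ^-Δ (suc k) A i j = ≡.cong₂ _-_ (Δ^-Δ k A (suc i) j) (Δ^-Δ k A i j)

  RowRecurrence : Matrix → Matrix → Set ℓ
  RowRecurrence P A = ∀ i j → A (suc i) j ≈ Σ< R (suc j) (λ m → A i m * P m j)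

  Δ-rowRecurrence : ∀ {P A} → RowRecurrence P A → RowRecurrence P (Δ A)
  Δ-rowRecurrence {P} {A} rec i j = begin
    A (suc (suc i)) j - A (suc i) j
      ≈⟨ +-cong (rec (suc i) j) (-‿cong (rec i j)) ⟩
    Σ< R (suc j) (λ m → A (suc i) m * P m j) - Σ< R (suc j) (λ m → A i m * P m j)
      ≈⟨ +-cong refl (-‿distrib-Σ< (suc j) (λ m → A i m * P m j)) ⟩
    Σ< R (suc j) (λ m → A (suc i) m * P m j) + Σ< R (suc j) (λ m → - (A i m * P m j))
      ≈⟨ Σ<-distrib-+ (suc j) _ _ ⟨
    Σ< R (suc j) (λ m → A (suc i) m * P m j - A i m * P m j)
      ≈⟨ Σ<-cong (suc j) (λ m _ → [y-z]x≈yx-zx (P m j) _ _) ⟨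
    Σ< R (suc j) (λ m → Δ A i m * P m j)
      ∎

  Δ^-rowRecurrence : ∀ {P A} → RowRecurrence P A → ∀ k → RowRecurrence P (Δ^ k A)
  Δ^-rowRecurrence rec zero    = rec
  Δ^-rowRecurrence rec (suc k) = Δ-rowRecurrence (Δ^-rowRecurrence rec k)

  -- For unitriangular P, Δ A = A (P - 1) with P - 1 strictly upper triangular: each difference adds a
  -- vanishing leading column and multiplies the new diagonal entry by a superdiagonal entry of P.
  module UnitriangularRecurrence {P : Matrix} (P-diag : ∀ j → P j j ≈ 1#) where

    Δ-as-Σ< : ∀ {A} → RowRecurrence P A → ∀ i j → Δ A i j ≈ Σ< R j (λ m → A i m * P m j)
    Δ-as-Σ< {A} rec i j = begin
      A (suc i) j - A i j
        ≈⟨ +-cong (rec i j) refl ⟩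
      (Σ< R j (λ m → A i m * P m j) + A i j * P j j) - A i j
        ≈⟨ +-cong (+-cong refl (trans (*-cong refl (P-diag j)) (*-identityʳ _))) refl ⟩
      (Σ< R j (λ m → A i m * P m j) + A i j) - A i j
        ≈⟨ //-rightDividesʳ (A i j) _ ⟩
      Σ< R j (λ m → A i m * P m j)
        ∎

    Δ^-vanish : ∀ {A} → RowRecurrence P A → ∀ k i j → j ℕ.< k → Δ^ k A i j ≈ 0#
    Δ^-vanish rec zero    i j ()
    Δ^-vanish rec (suc k) i j j≤k = trans (Δ-as-Σ< (Δ^-rowRecurrence rec k) i j) (Σ<-zero j (λ m m<j →
      trans (*-cong (Δ^-vanish rec k i m (ℕ.<-≤-trans m<j (ℕ.≤-pred j≤k))) refl) (zeroˡ _)))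

    Δ^-diag : ∀ {A} → RowRecurrence P A → ∀ k i → Δ^ (suc k) A i (suc k) ≈ Δ^ k A i k * P k (suc k)
    Δ^-diag {A} rec k i = begin
      Δ^ (suc k) A i (suc k)
        ≈⟨ Δ-as-Σ< (Δ^-rowRecurrence rec k) i (suc k) ⟩
      Σ< R k (λ m → Δ^ k A i m * P m (suc k)) + Δ^ k A i k * P k (suc k)
        ≈⟨ +-cong (Σ<-zero k (λ m m<k → trans (*-cong (Δ^-vanish rec k i m m<k) refl) (zeroˡ _))) refl ⟩
      0# + Δ^ k A i k * P k (suc k)
        ≈⟨ +-identityˡ _ ⟩
      Δ^ k A i k * P k (suc k)
        ∎

  module Iterates (f : Series R) (f0≈0 : f 0 ≈ 0#) (f1≈1 : f 1 ≈ 1#) where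

    iter-vanish : ∀ i → iter R f i 0 ≈ 0#
    iter-vanish zero    = refl
    iter-vanish (suc i) = comp-vanish f (iter R f i) f0≈0

    iter-sucʳ : ∀ i → iter R f (suc i) ≋ comp R (iter R f i) f
    iter-sucʳ zero    n = trans (comp-identityʳ f n) (sym (comp-identityˡ f0≈0 n))
    iter-sucʳ (suc i) n =
      trans (comp-cong (λ _ → refl) (iter-sucʳ i) n) (sym (comp-assoc f (iter-vanish i) f0≈0 n))

    below-diag-vanish : ∀ k (u : ℕ → Carrier) → Σ< R k (λ p → u p * powS R f k (k ∸ suc p)) ≈ 0#
    below-diag-vanish k u = Σ<-zero k (λ p p<k →
      trans (*-cong refl (powS-vanish f0≈0 k (k ∸ suc p) (ℕ.∸-monoʳ-< (s≤s z≤n) p<k))) (zeroʳ _))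

    powS-diag : ∀ k → powS R f k k ≈ 1#
    powS-diag zero    = refl
    powS-diag (suc k) = begin
      powS R f (suc k) (suc k)
        ≈⟨ mulS-suc (powS R f k) k f0≈0 ⟩
      Σ< R (suc k) (λ p → f (suc p) * powS R f k (k ∸ p))
        ≈⟨ Σ<-head k _ ⟩
      f 1 * powS R f k k + Σ< R k (λ p → f (suc (suc p)) * powS R f k (k ∸ suc p))
        ≈⟨ +-cong (*-cong f1≈1 (powS-diag k)) (below-diag-vanish k _) ⟩
      1# * 1# + 0#
        ≈⟨ trans (+-identityʳ _) (*-identityˡ 1#) ⟩
      1#
        ∎

    powS-superdiag : ∀ k → powS R f k (suc k) ≈ fromℕ R k * f 2
    powS-superdiag zero    = sym (zeroˡ (f 2))
    powS-superdiag (suc k) = begin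
      powS R f (suc k) (suc (suc k))
        ≈⟨ mulS-suc (powS R f k) (suc k) f0≈0 ⟩
      Σ< R (suc (suc k)) (λ p → f (suc p) * powS R f k (suc k ∸ p))
        ≈⟨ Σ<-head (suc k) _ ⟩
      f 1 * powS R f k (suc k) + Σ< R (suc k) (λ p → f (2 ℕ.+ p) * powS R f k (k ∸ p))
        ≈⟨ +-cong refl (Σ<-head k _) ⟩
      f 1 * powS R f k (suc k) + (f 2 * powS R f k k + Σ< R k (λ p → f (3 ℕ.+ p) * powS R f k (k ∸ suc p)))
        ≈⟨ +-cong (*-cong f1≈1 (powS-superdiag k))
                  (+-cong (*-cong refl (powS-diag k)) (below-diag-vanish k _)) ⟩
      1# * (fromℕ R k * f 2) + (f 2 * 1# + 0#)
        ≈⟨ +-cong (*-identityˡ _) (trans (+-identityʳ _) (*-identityʳ _)) ⟩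
      fromℕ R k * f 2 + f 2
        ≈⟨ trans (+-comm _ _) (+-cong (sym (*-identityˡ (f 2))) refl) ⟩
      1# * f 2 + fromℕ R k * f 2
        ≈⟨ distribʳ (f 2) 1# (fromℕ R k) ⟨
      fromℕ R (suc k) * f 2
        ∎

    coeff : Matrix
    coeff i j = iter R f i (suc j)

    transfer : Matrix
    transfer m j = powS R f (suc m) (suc j)

    coeff-rowRecurrence : RowRecurrence transfer coeff
    coeff-rowRecurrence i j =
      trans (iter-sucʳ i (suc j)) (Σ<-tail (suc j) (trans (*-cong (iter-vanish i) refl) (zeroˡ _)))

    open UnitriangularRecurrence {transfer} (λ j → powS-diag (suc j)) public

    Δ^coeff-diag : ∀ k → Δ^ k coeff 0 k ≈ fromℕ R (k !) * powR R (f 2) k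
    Δ^coeff-diag zero    = sym (trans (*-identityʳ _) (+-identityʳ 1#))
    Δ^coeff-diag (suc k) = begin
      Δ^ (suc k) coeff 0 (suc k)
        ≈⟨ Δ^-diag coeff-rowRecurrence k 0 ⟩
      Δ^ k coeff 0 k * transfer k (suc k)
        ≈⟨ *-cong (Δ^coeff-diag k) (powS-superdiag (suc k)) ⟩
      (fromℕ R (k !) * powR R (f 2) k) * (fromℕ R (suc k) * f 2)
        ≈⟨ *-interchange _ _ _ _ ⟩
      (fromℕ R (k !) * fromℕ R (suc k)) * (powR R (f 2) k * f 2)
        ≈⟨ *-cong (*-comm _ _) (*-comm _ _) ⟩
      (fromℕ R (suc k) * fromℕ R (k !)) * (f 2 * powR R (f 2) k)
        ≈⟨ *-cong (fromℕ-homo-* (suc k) (k !)) refl ⟨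
      fromℕ R (suc k !) * powR R (f 2) (suc k)
        ∎

  -- Determinants

  sum-linear : ∀ {n} t (x y : Fin n → Carrier) → sum (λ j → x j + t * y j) ≈ sum x + t * sum y
  sum-linear t x y = trans (∑-distrib-+ x (λ j → t * y j)) (+-cong refl (sym (*-distribˡ-sum t y)))

  -‿distrib-sum : ∀ {n} (x : Fin n → Carrier) → - sum x ≈ sum (λ j → - x j)
  -‿distrib-sum x = begin
    - sum x                   ≈⟨ -1*x≈-x _ ⟨
    - 1# * sum x              ≈⟨ *-distribˡ-sum (- 1#) x ⟩
    sum (λ j → - 1# * x j)    ≈⟨ sum-cong-≋ {x = λ j → - 1# * x j} {y = λ j → - x j} (λ j → -1*x≈-x (x j)) ⟩
    sum (λ j → - x j)         ∎

  punchIn-pinch : ∀ {n} (j : Fin (suc n)) (k : Fin n) → punchIn (punchIn j k) (pinch k j) ≡ j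
  punchIn-pinch zero    zero    = ≡.refl
  punchIn-pinch zero    (suc k) = ≡.refl
  punchIn-pinch (suc j) zero    = ≡.refl
  punchIn-pinch (suc j) (suc k) = ≡.cong suc (punchIn-pinch j k)

  punchIn-punchIn-pinch : ∀ {n} (j : Fin (suc (suc n))) (k : Fin (suc n)) (s : Fin n) →
    punchIn j (punchIn k s) ≡ punchIn (punchIn j k) (punchIn (pinch k j) s)
  punchIn-punchIn-pinch zero    k       s       = ≡.refl
  punchIn-punchIn-pinch (suc j) zero    s       = ≡.refl
  punchIn-punchIn-pinch (suc j) (suc k) zero    = ≡.refl
  punchIn-punchIn-pinch (suc j) (suc k) (suc s) = ≡.cong suc (punchIn-punchIn-pinch j k s)

  sign : ∀ {n} → Fin n → Carrier
  sign j = powR R (- 1#) (toℕ j)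

  minor : ∀ {n} → (Fin (suc n) → Fin (suc n) → Carrier) → Fin (suc n) → Fin n → Fin n → Carrier
  minor M j r s = M (suc r) (punchIn j s)

  laplaceTerms : ∀ {n} → (Fin (suc n) → Fin (suc n) → Carrier) → Fin (suc n) → Carrier
  laplaceTerms {n} M j = sign j * (M zero j * det R n (minor M j))

  det-expand : ∀ n (M : Fin (suc n) → Fin (suc n) → Carrier) → det R (suc n) M ≡ sum (laplaceTerms M)
  det-expand n M = ΣFin≡sum (laplaceTerms M)
    where
    ΣFin≡sum : ∀ {n} (g : Fin n → Carrier) → ΣFin R g ≡ sum g
    ΣFin≡sum {zero}  g = ≡.refl
    ΣFin≡sum {suc n} g = ≡.cong (g zero +_) (ΣFin≡sum (λ i → g (suc i)))

  det-cong-laplace : ∀ n {M N : Fin (suc n) → Fin (suc n) → Carrier} →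
    (∀ j → M zero j ≈ N zero j) → (∀ j → det R n (minor M j) ≈ det R n (minor N j)) →
    det R (suc n) M ≈ det R (suc n) N
  det-cong-laplace n {M} {N} row₀ minors = begin
    det R (suc n) M
      ≡⟨ det-expand n M ⟩
    sum (laplaceTerms M)
      ≈⟨ sum-cong-≋ {x = laplaceTerms M} {y = laplaceTerms N}
                    (λ j → *-cong refl (*-cong (row₀ j) (minors j))) ⟩
    sum (laplaceTerms N)
      ≡⟨ det-expand n N ⟨
    det R (suc n) N
      ∎

  det-cong : ∀ n {M N : Fin n → Fin n → Carrier} → (∀ i j → M i j ≈ N i j) → det R n M ≈ det R n N
  det-cong zero            M≈N = refl
  det-cong (suc n) {M} {N} M≈N =
    det-cong-laplace n {M} {N} (M≈N zero) (λ j → det-cong n (λ r s → M≈N (suc r) (punchIn j s)))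

  det-linear-first-row : ∀ n {M N N′ : Fin (suc n) → Fin (suc n) → Carrier} t →
    (∀ j → M zero j ≈ N zero j + t * N′ zero j) →
    (∀ r j → M (suc r) j ≈ N (suc r) j) → (∀ r j → N′ (suc r) j ≈ N (suc r) j) →
    det R (suc n) M ≈ det R (suc n) N + t * det R (suc n) N′
  det-linear-first-row n {M} {N} {N′} t row₀ rest rest′ = begin
    det R (suc n) M
      ≡⟨ det-expand n M ⟩
    sum (laplaceTerms M)
      ≈⟨ sum-cong-≋ {x = laplaceTerms M} {y = λ j → laplaceTerms N j + t * laplaceTerms N′ j}
           (λ j → trans (*-cong refl (*-cong (row₀ j) (det-cong n (λ r s → rest r _)))) (expand j)) ⟩
    sum (λ j → laplaceTerms N j + t * laplaceTerms N′ j)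
      ≈⟨ sum-linear t (laplaceTerms N) (laplaceTerms N′) ⟩
    sum (laplaceTerms N) + t * sum (laplaceTerms N′)
      ≡⟨ ≡.cong₂ (λ x y → x + t * y) (det-expand n N) (det-expand n N′) ⟨
    det R (suc n) N + t * det R (suc n) N′
      ∎
    where
    expand : ∀ j → sign j * ((N zero j + t * N′ zero j) * det R n (minor N j)) ≈
                   laplaceTerms N j + t * laplaceTerms N′ j
    expand j = begin
      sign j * ((N zero j + t * N′ zero j) * d)        ≈⟨ *-cong refl (distribʳ d _ _) ⟩
      sign j * (N zero j * d + (t * N′ zero j) * d)    ≈⟨ distribˡ (sign j) _ _ ⟩
      sign j * (N zero j * d) + sign j * ((t * N′ zero j) * d)
        ≈⟨ +-cong refl (trans (*-cong refl (*-assoc t _ d)) (x∙yz≈y∙xz (sign j) t _)) ⟩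
      sign j * (N zero j * d) + t * (sign j * (N′ zero j * d))
        ≈⟨ +-cong refl (*-cong refl (*-cong refl (*-cong refl (det-cong n (λ r s → sym (rest′ r _)))))) ⟩
      sign j * (N zero j * d) + t * (sign j * (N′ zero j * det R n (minor N′ j)))
        ∎
      where
      d : Carrier
      d = det R n (minor N j)

  -- Deleting column j and then column k of the rest removes the same two columns as deleting punchIn j k
  -- and then pinch k j; the two orders come with opposite signs.
  signedDoubleSum-vanish : ∀ n (G : Fin (suc n) → Fin n → Carrier) →
    (∀ j k → G j k ≈ G (punchIn j k) (pinch k j)) →
    sum (λ j → sign j * sum (λ k → sign k * G j k)) ≈ 0#
  signedDoubleSum-vanish zero    G _   = trans (+-identityʳ _) (zeroʳ _)
  signedDoubleSum-vanish (suc n) G sym-G = begin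
    1# * A + sum (λ j → sign (suc j) * (1# * u j + sum (λ k → sign (suc k) * G′ j k)))
      ≈⟨ +-cong (*-identityˡ A)
                (sum-cong-≋ {x = λ j → sign (suc j) * (1# * u j + sum (λ k → sign (suc k) * G′ j k))}
                            {y = λ j → - (sign j * u j) + sign j * Y j} term) ⟩
    A + sum (λ j → - (sign j * u j) + sign j * Y j)
      ≈⟨ +-cong refl (∑-distrib-+ (λ j → - (sign j * u j)) (λ j → sign j * Y j)) ⟩
    A + (sum (λ j → - (sign j * u j)) + sum (λ j → sign j * Y j))
      ≈⟨ +-cong refl (+-cong (sym (-‿distrib-sum (λ j → sign j * u j)))
                             (signedDoubleSum-vanish n G′ (λ j k → sym-G (suc j) (suc k)))) ⟩
    A + (- sum (λ j → sign j * u j) + 0#)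
      ≈⟨ +-cong refl (trans (+-identityʳ _)
           (-‿cong (sum-cong-≋ {x = λ j → sign j * u j} {y = λ j → sign j * G zero j}
                               (λ j → *-cong refl (sym-G (suc j) zero))))) ⟩
    A + - A
      ≈⟨ -‿inverseʳ A ⟩
    0#
      ∎
    where
    A : Carrier
    A = sum (λ k → sign k * G zero k)
    u : Fin (suc n) → Carrier
    u j = G (suc j) zero
    G′ : Fin (suc n) → Fin n → Carrier
    G′ j k = G (suc j) (suc k)
    Y : Fin (suc n) → Carrier
    Y j = sum (λ k → sign k * G′ j k)
    term : ∀ j → sign (suc j) * (1# * u j + sum (λ k → sign (suc k) * G′ j k)) ≈
                 - (sign j * u j) + sign j * Y j
    term j = begin
      (- 1# * s) * (1# * u j + sum (λ k → sign (suc k) * G′ j k))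
        ≈⟨ *-cong refl (+-cong (*-identityˡ (u j)) flipped) ⟩
      (- 1# * s) * (u j + - Y j)
        ≈⟨ trans (*-assoc _ _ _) (-1*x≈-x _) ⟩
      - (s * (u j + - Y j))
        ≈⟨ -‿cong (trans (distribˡ s _ _) (+-cong refl (sym (-‿distribʳ-* s (Y j))))) ⟩
      - (s * u j + - (s * Y j))
        ≈⟨ -‿+-comm _ _ ⟨
      - (s * u j) + - - (s * Y j)
        ≈⟨ +-cong refl (-‿involutive _) ⟩
      - (s * u j) + s * Y j
        ∎
      where
      s : Carrier
      s = sign j
      flipped : sum (λ k → sign (suc k) * G′ j k) ≈ - Y j
      flipped = begin
        sum (λ k → (- 1# * sign k) * G′ j k)
          ≈⟨ sum-cong-≋ {x = λ k → (- 1# * sign k) * G′ j k} {y = λ k → - (sign k * G′ j k)}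
                        (λ k → trans (*-assoc _ _ _) (-1*x≈-x _)) ⟩
        sum (λ k → - (sign k * G′ j k))
          ≈⟨ -‿distrib-sum (λ k → sign k * G′ j k) ⟨
        - Y j
          ∎

  det-equal-first-rows : ∀ n (M : Fin (suc (suc n)) → Fin (suc (suc n)) → Carrier) →
    (∀ j → M zero j ≈ M (suc zero) j) → det R (suc (suc n)) M ≈ 0#
  det-equal-first-rows n M row₀≈row₁ = begin
    det R (suc (suc n)) M
      ≡⟨ det-expand (suc n) M ⟩
    sum (laplaceTerms M)
      ≈⟨ sum-cong-≋ {x = laplaceTerms M} {y = λ j → sign j * sum (λ k → sign k * G j k)}
                    (λ j → *-cong refl (expand j)) ⟩
    sum (λ j → sign j * sum (λ k → sign k * G j k))
      ≈⟨ signedDoubleSum-vanish (suc n) G G-symmetric ⟩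
    0#
      ∎
    where
    E : Fin (suc (suc n)) → Fin (suc n) → Carrier
    E j k = det R n (λ r s → M (suc (suc r)) (punchIn j (punchIn k s)))
    G : Fin (suc (suc n)) → Fin (suc n) → Carrier
    G j k = M zero j * (M (suc zero) (punchIn j k) * E j k)
    expand : ∀ j → M zero j * det R (suc n) (minor M j) ≈ sum (λ k → sign k * G j k)
    expand j = begin
      M zero j * det R (suc n) (minor M j)          ≡⟨ ≡.cong (M zero j *_) (det-expand n (minor M j)) ⟩
      M zero j * sum (laplaceTerms (minor M j))     ≈⟨ *-distribˡ-sum (M zero j) (laplaceTerms (minor M j)) ⟩
      sum (λ k → M zero j * laplaceTerms (minor M j) k)
        ≈⟨ sum-cong-≋ {x = λ k → M zero j * laplaceTerms (minor M j) k} {y = λ k → sign k * G j k}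
                      (λ _ → x∙yz≈y∙xz _ _ _) ⟩
      sum (λ k → sign k * G j k)                    ∎
    G-symmetric : ∀ j k → G j k ≈ G (punchIn j k) (pinch k j)
    G-symmetric j k = begin
      M zero j * (M (suc zero) l * E j k)   ≈⟨ *-cong (row₀≈row₁ j) (*-cong (sym (row₀≈row₁ l)) refl) ⟩
      M (suc zero) j * (M zero l * E j k)   ≈⟨ x∙yz≈y∙xz _ _ _ ⟩
      M zero l * (M (suc zero) j * E j k)
        ≈⟨ *-cong refl (*-cong (reflexive (≡.cong (M (suc zero)) (≡.sym (punchIn-pinch j k))))
             (det-cong n (λ r s → reflexive (≡.cong (M (suc (suc r))) (punchIn-punchIn-pinch j k s))))) ⟩
      M zero l * (M (suc zero) (punchIn l (pinch k j)) * E l (pinch k j))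
        ∎
      where
      l : Fin (suc (suc n))
      l = punchIn j k

  det-add-row₀-to-row₁ : ∀ n {M N : Fin (suc (suc n)) → Fin (suc (suc n)) → Carrier} t →
    (∀ j → M zero j ≈ N zero j) → (∀ j → M (suc zero) j ≈ N (suc zero) j + t * N zero j) →
    (∀ r j → M (suc (suc r)) j ≈ N (suc (suc r)) j) → det R (suc (suc n)) M ≈ det R (suc (suc n)) N
  det-add-row₀-to-row₁ n {M} {N} t row₀ row₁ rest = begin
    det R (suc (suc n)) M
      ≡⟨ det-expand (suc n) M ⟩
    sum (laplaceTerms M)
      ≈⟨ sum-cong-≋ {x = laplaceTerms M} {y = λ j → laplaceTerms N j + t * laplaceTerms N′ j} term ⟩
    sum (λ j → laplaceTerms N j + t * laplaceTerms N′ j)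
      ≈⟨ sum-linear t (laplaceTerms N) (laplaceTerms N′) ⟩
    sum (laplaceTerms N) + t * sum (laplaceTerms N′)
      ≡⟨ ≡.cong₂ (λ x y → x + t * y) (det-expand (suc n) N) (det-expand (suc n) N′) ⟨
    det R (suc (suc n)) N + t * det R (suc (suc n)) N′
      ≈⟨ +-cong refl (trans (*-cong refl (det-equal-first-rows n N′ (λ _ → refl))) (zeroʳ t)) ⟩
    det R (suc (suc n)) N + 0#
      ≈⟨ +-identityʳ _ ⟩
    det R (suc (suc n)) N
      ∎
    where
    N′ : Fin (suc (suc n)) → Fin (suc (suc n)) → Carrier
    N′ zero          = N zero
    N′ (suc zero)    = N zero
    N′ (suc (suc r)) = N (suc (suc r))
    term : ∀ j → laplaceTerms M j ≈ laplaceTerms N j + t * laplaceTerms N′ j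
    term j = begin
      sign j * (M zero j * det R (suc n) (minor M j))
        ≈⟨ *-cong refl (*-cong (row₀ j) (det-linear-first-row n {minor M j} {minor N j} {minor N′ j} t
                                           (λ s → row₁ _) (λ r s → rest r _) (λ r s → refl))) ⟩
      sign j * (N zero j * (d + t * d′))
        ≈⟨ trans (*-cong refl (distribˡ _ _ _)) (distribˡ _ _ _) ⟩
      sign j * (N zero j * d) + sign j * (N zero j * (t * d′))
        ≈⟨ +-cong refl (trans (*-cong refl (x∙yz≈y∙xz _ _ _)) (x∙yz≈y∙xz _ _ _)) ⟩
      sign j * (N zero j * d) + t * (sign j * (N zero j * d′))
        ∎
      where
      d d′ : Carrier
      d  = det R (suc n) (minor N j)
      d′ = det R (suc n) (minor N′ j)

  det-zero-first-column : ∀ n (M : Fin (suc n) → Fin (suc n) → Carrier) → (∀ r → M r zero ≈ 0#) →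
    det R (suc n) M ≈ 0#
  laplaceTerms-tail-vanish : ∀ n (M : Fin (suc n) → Fin (suc n) → Carrier) → (∀ r → M (suc r) zero ≈ 0#) →
    sum (λ j → laplaceTerms M (suc j)) ≈ 0#

  det-zero-first-column n M col₀ = begin
    det R (suc n) M
      ≡⟨ det-expand n M ⟩
    laplaceTerms M zero + sum (λ j → laplaceTerms M (suc j))
      ≈⟨ +-cong head-vanish (laplaceTerms-tail-vanish n M (λ r → col₀ (suc r))) ⟩
    0# + 0#
      ≈⟨ +-identityʳ 0# ⟩
    0#
      ∎
    where
    head-vanish : laplaceTerms M zero ≈ 0#
    head-vanish = trans (*-cong refl (trans (*-cong (col₀ zero) refl) (zeroˡ _))) (zeroʳ _)

  laplaceTerms-tail-vanish zero    M _    = refl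
  laplaceTerms-tail-vanish (suc n) M col₀ = trans
    (sum-cong-≋ {x = λ j → laplaceTerms M (suc j)} {y = λ _ → 0#} (λ j → trans
      (*-cong refl (trans (*-cong refl (det-zero-first-column n (minor M (suc j)) col₀)) (zeroʳ _)))
      (zeroʳ _)))
    (sum-replicate-zero (suc n))

  det-first-column-zero-below : ∀ n (M : Fin (suc n) → Fin (suc n) → Carrier) → (∀ r → M (suc r) zero ≈ 0#) →
    det R (suc n) M ≈ M zero zero * det R n (minor M zero)
  det-first-column-zero-below n M col₀ = begin
    det R (suc n) M
      ≡⟨ det-expand n M ⟩
    laplaceTerms M zero + sum (λ j → laplaceTerms M (suc j))
      ≈⟨ +-cong (*-identityˡ _) (laplaceTerms-tail-vanish n M col₀) ⟩
    M zero zero * det R n (minor M zero) + 0#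
      ≈⟨ +-identityʳ _ ⟩
    M zero zero * det R n (minor M zero)
      ∎

  det-upperTriangular : ∀ n (M : Fin n → Fin n → Carrier) → (∀ i j → toℕ j ℕ.< toℕ i → M i j ≈ 0#) →
    det R n M ≈ ∏ (λ i → M i i)
  det-upperTriangular zero    M lower = refl
  det-upperTriangular (suc n) M lower =
    trans (det-first-column-zero-below n M (λ r → lower (suc r) zero (s≤s z≤n)))
          (*-cong refl (det-upperTriangular n (minor M zero) (λ i j j<i → lower (suc i) (suc j) (s≤s j<i))))

  submatrix : ∀ m → Matrix → (Fin m → ℕ) → Fin m → Fin m → Carrier
  submatrix m A col i j = A (toℕ i) (col j)

  rowDifferences : Matrix → Matrix
  rowDifferences A zero    = A zero
  rowDifferences A (suc i) = Δ A i

  -- Adding row 0 to row 1 turns rowDifferences A into A 0 on top of rowDifferences (A ∘ suc), which the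
  -- Laplace expansion hands to the induction hypothesis; general column maps keep the minors submatrices.
  det-rowDifferences : ∀ m A col →
    det R m (submatrix m (rowDifferences A) col) ≈ det R m (submatrix m A col)
  det-rowDifferences zero          A col = refl
  det-rowDifferences (suc zero)    A col =
    det-cong-laplace 0 {submatrix 1 (rowDifferences A) col} {submatrix 1 A col} (λ _ → refl) (λ _ → refl)
  det-rowDifferences (suc (suc m)) A col = begin
    det R (suc (suc m)) (submatrix (suc (suc m)) (rowDifferences A) col)
      ≈⟨ det-add-row₀-to-row₁ m {submatrix _ (rowDifferences A) col} {submatrix _ B col} (- 1#)
           (λ _ → refl) (λ _ → +-cong refl (sym (-1*x≈-x _))) (λ _ _ → refl) ⟩
    det R (suc (suc m)) (submatrix (suc (suc m)) B col)
      ≈⟨ det-cong-laplace (suc m) {submatrix _ B col} {submatrix _ A col} (λ _ → refl)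
           (λ j → det-rowDifferences (suc m) (λ i → A (suc i)) (col ∘ punchIn j)) ⟩
    det R (suc (suc m)) (submatrix (suc (suc m)) A col)
      ∎
    where
    B : Matrix
    B zero    = A zero
    B (suc i) = rowDifferences (λ i → A (suc i)) i

  forwardDifferences : Matrix → Matrix
  forwardDifferences A i = Δ^ i A 0

  det-forwardDifferences : ∀ m A col →
    det R m (submatrix m (forwardDifferences A) col) ≈ det R m (submatrix m A col)
  det-forwardDifferences zero    A col = refl
  det-forwardDifferences (suc m) A col = begin
    det R (suc m) (submatrix (suc m) (forwardDifferences A) col)
      ≈⟨ det-cong-laplace m {submatrix _ (forwardDifferences A) col} {submatrix _ (rowDifferences A) col}
           (λ _ → refl) minors ⟩
    det R (suc m) (submatrix (suc m) (rowDifferences A) col)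
      ≈⟨ det-rowDifferences (suc m) A col ⟩
    det R (suc m) (submatrix (suc m) A col)
      ∎
    where
    minors : ∀ j → det R m (submatrix m (λ i → forwardDifferences A (suc i)) (col ∘ punchIn j)) ≈
                   det R m (submatrix m (Δ A) (col ∘ punchIn j))
    minors j = begin
      det R m (submatrix m (λ i → forwardDifferences A (suc i)) (col ∘ punchIn j))
        ≈⟨ det-cong m (λ r s → reflexive (≡.sym (Δ^-Δ (toℕ r) A 0 _))) ⟩
      det R m (submatrix m (forwardDifferences (Δ A)) (col ∘ punchIn j))
        ≈⟨ det-forwardDifferences m (Δ A) (col ∘ punchIn j) ⟩
      det R m (submatrix m (Δ A) (col ∘ punchIn j))
        ∎

open import Data.Nat using (_*_; _/_)

theorem2 : ∀ {c ℓ} (R : CommutativeRing c ℓ) (f : Series R) →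
    CommutativeRing._≈_ R (f 0) (CommutativeRing.0# R) →
    CommutativeRing._≈_ R (f 1) (CommutativeRing.1# R) →
    (n : ℕ) →
    CommutativeRing._≈_ R
      (det R (suc n) (λ i j → iter R f (toℕ i) (suc (toℕ j))))
      (CommutativeRing._*_ R (superfact R n) (powR R (f 2) ((n * suc n) / 2)))
theorem2 R f f0≈0 f1≈1 n = begin
  det R (suc n) (submatrix R (suc n) coeff toℕ)
    ≈⟨ det-forwardDifferences R (suc n) coeff toℕ ⟨
  det R (suc n) (submatrix R (suc n) (forwardDifferences R coeff) toℕ)
    ≈⟨ det-upperTriangular R (suc n) _ (λ i j → Δ^-vanish coeff-rowRecurrence (toℕ i) 0 (toℕ j)) ⟩
  ∏ (λ (i : Fin (suc n)) → Δ^ R (toℕ i) coeff 0 (toℕ i))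
    ≈⟨ ∏-cong-≋ {x = λ (i : Fin (suc n)) → Δ^ R (toℕ i) coeff 0 (toℕ i)}
                {y = λ i → fromℕ R (toℕ i !) *ᴿ powR R (f 2) (toℕ i)} (λ i → Δ^coeff-diag (toℕ i)) ⟩
  ∏ (λ (i : Fin (suc n)) → fromℕ R (toℕ i !) *ᴿ powR R (f 2) (toℕ i))
    ≈⟨ ∏-factorialPowers R (f 2) n ⟩
  superfact R n *ᴿ powR R (f 2) ((n * suc n) / 2)
    ∎
  where
  open CommutativeRing R using (setoid; *-monoid) renaming (_*_ to _*ᴿ_)
  open SetoidReasoning setoid
  open import Algebra.Properties.Monoid.Sum *-monoid using () renaming (sum to ∏; sum-cong-≋ to ∏-cong-≋)
  open Iterates R f f0≈0 f1≈1
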